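{- Let $L$ be a matroid on a finite set $E$ and let $Q$ be a quotient of $L$. Set $k=r(L)-r(Q)$ and let $K$ be a subset of $\{0,1,\ldots,k\}$ such that $\{0,1,\ldots,k\}-K$ contains no pair of consecutive integers. Then $\left(E,\ \bigcup_{i\in K}\mathcal{B}(H^i_{Q,L})\right)$ is a delta-matroid, where $H^i_{Q,L}$ denotes the $i$-th Higgs lift of $Q$ toward $L$.
   Context: A set system is a pair $(E,\mathcal{F})$ with $E$ finite and $\mathcal{F}$ a collection of subsets of $E$ (feasible sets); it is proper if $\mathcal{F}\neq\emptyset$. A delta-matroid is a proper set system $(E,\mathcal{F})$ such that for all $X,Y\in\mathcal{F}$ and every $u\in X\triangle Y$ there is $v\in X\triangle Y$ (possibly $v=u$) with $X\triangle\{u,v\}\in\mathcal{F}$. For matroids $Q,L$ on $E$, $Q$ is a quotient of $L$ if there is a matroid $M$ and a set $X\subseteq E(M)$ with $M\backslash X=L$ and $M/X=Q$. If $Q$ is a quotient of $L$ and $0\le i\le r(L)-r(Q)$, the $i$-th Higgs lift $H^i_{Q,L}$ is the matroid on $E$ with rank function $r_i(X)=\min\{r_Q(X)+i,\ r_L(X)\}$; its bases are exactly the sets of size $r(Q)+i$ that contain a basis of $Q$ and are contained in a basis of $L$. $\mathcal{B}(N)$ denotes the set of bases of a matroid $N$. -}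

module Defs where

open import Data.Nat using (ℕ; _≤_; _+_; _∸_; _⊓_)
open import Data.Bool using (Bool; true; false; _xor_)
open import Data.Fin using (Fin; toℕ; inject₁; suc)
open import Data.Fin.Subset using (Subset; _∈_; _⊆_; _∪_; _∩_; ∣_∣; ⁅_⁆; ⊤; ⊥)
open import Data.Vec using (zipWith; replicate; _++_)
open import Data.Product using (Σ; _×_; ∃; ∃-syntax; _,_)
open import Data.Sum using (_⊎_)
open import Relation.Binary.PropositionalEquality using (_≡_)

record Matroid (n : ℕ) : Set where
  field
    rank      : Subset n → ℕ
    rank-≤    : ∀ A → rank A ≤ ∣ A ∣
    rank-mono : ∀ {A B} → A ⊆ B → rank A ≤ rank B
    rank-sub  : ∀ A B → rank (A ∪ B) + rank (A ∩ B) ≤ rank A + rank B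
open Matroid public

r : ∀ {n} → Matroid n → ℕ
r M = rank M ⊤

-- B is a basis of the matroid with rank function ρ: B independent and spanning.
IsBasisOf : ∀ {n} → (Subset n → ℕ) → Subset n → Set
IsBasisOf ρ B = (ρ B ≡ ∣ B ∣) × (ρ B ≡ ρ ⊤)

-- Q is a quotient of L: there is a matroid M on E ⊔ X (X = the last m elements)
-- with M \ X = L and M / X = Q (compared via rank functions).
IsQuotient : ∀ {n} → Matroid n → Matroid n → Set
IsQuotient {n} Q L =
  Σ ℕ λ m → Σ (Matroid (n + m)) λ M →
    (∀ A → rank L A ≡ rank M (A ++ replicate m false)) ×
    (∀ A → rank Q A ≡ rank M (A ++ replicate m true) ∸ rank M (replicate n false ++ replicate m true))

higgsRank : ∀ {n} → Matroid n → Matroid n → ℕ → Subset n → ℕ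
higgsRank Q L i X = (rank Q X + i) ⊓ rank L X

_△_ : ∀ {n} → Subset n → Subset n → Subset n
X △ Y = zipWith _xor_ X Y

IsDeltaMatroid : ∀ {n} → (Subset n → Set) → Set
IsDeltaMatroid {n} F =
  (∃[ X ] F X) ×
  (∀ X Y → F X → F Y → ∀ u → u ∈ (X △ Y) →
     ∃[ v ] (v ∈ (X △ Y) × F (X △ (⁅ u ⁆ ∪ ⁅ v ⁆))))

-- feasible sets: ⋃_{i ∈ K} B(H^i_{Q,L}),  K ⊆ {0,…,k} encoded as Subset (suc k)
HiggsUnion : ∀ {n} (Q L : Matroid n) {k : ℕ} → Subset (ℕ.suc k) → Subset n → Set
HiggsUnion Q L {k} K B = ∃[ i ] (i ∈ K × IsBasisOf (higgsRank Q L (toℕ i)) B)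

NoConsecutiveGap : ∀ {k} → Subset (ℕ.suc k) → Set
NoConsecutiveGap {k} K = ∀ (j : Fin k) → (inject₁ j ∈ K) ⊎ (suc j ∈ K)

-- A basis of the Higgs lift H^ℓ_{Q,L} is an L-independent, Q-spanning set with r(Q) + ℓ
-- elements, and for A ⊆ B the quotient gives r_Q(B) − r_Q(A) ≤ r_L(B) − r_L(A).  Let X, Y be
-- such bases at levels i, j ∈ K and u ∈ X △ Y, and toggle u in X.  If the result Z is still
-- L-independent and Q-spanning, it is a basis at level i ± 1; if that level is not in K it
-- differs from j, and augmenting Z from Y in L (below j) or shrinking it towards Y in Q (above j)
-- moves one level further, which lies in K because K has no two consecutive gaps.  Otherwise
-- X − u fails to span Q, and an element of Y raising its Q-rank repairs it at level i, or X + u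
-- is L-dependent, and deleting one of its non-coloops outside Y repairs it; in both cases the
-- quotient inequality transfers the rank change between Q and L.
module Submission where

open import Defs
open import Data.Bool.Properties using (xor-assoc; xor-comm; xor-identityˡ; xor-identityʳ)
open import Data.Fin using (Fin; zero; suc; toℕ; fromℕ<)
open import Data.Fin.Properties using (_≟_; any?; toℕ<n; toℕ-fromℕ<; toℕ-inject₁)
open import Data.Fin.Subset
  using (Subset; inside; outside; _∈_; _∉_; _⊆_; _∪_; _∩_; _─_; _-_; ∣_∣; ⁅_⁆; ⊤; ⊥; Nonempty)
open import Data.Fin.Subset.Properties
  using ( _∈?_; nonempty?; Empty-unique; ∣⊥∣≡0; ∣⁅x⁆∣≡1; ⊆⊤; ⊥⊆; ⊆-antisym; p⊆q⇒∣p∣≤∣q∣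
        ; x∈⁅x⁆; x∈⁅y⁆⇒x≡y; x∉⁅y⁆⇒x≢y
        ; x∈p∪q⁻; x∈p∪q⁺; p⊆p∪q; q⊆p∪q; x∈p∩q⁺; x∈p∩q⁻; p∩q⊆p; p∩q⊆q
        ; x∈p∧x∉q⇒x∈p─q; x∈p∧x≢y⇒x∈p-y; p─q⊆p; p─⊥≡p; p─q─r≡p─q∪r; x∈p⇒∣p-x∣<∣p∣
        ; ∪-identityˡ; ∪-identityʳ; ∪-idem; ∪-zeroˡ; ∩-zeroʳ; ∩-comm )
open import Data.Nat using (ℕ; zero; suc; _+_; _∸_; _≤_; _<_; _⊓_; _≤?_; _<?_; z<s; s≤s; s≤s⁻¹)
open import Data.Nat.Properties renaming (_≟_ to _≟ℕ_)
open import Data.Product using (_×_; _,_; ∃-syntax)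
open import Data.Sum using (_⊎_; inj₁; inj₂; [_,_]′; fromInj₁; fromInj₂)
import Data.Sum as Sum
open import Data.Vec using (_∷_; []; _++_; here; there)
open import Data.Vec.Properties using (zipWith-assoc; zipWith-comm; zipWith-identityˡ; zipWith-identityʳ; zipWith-++)
open import Function using (_∘_; id; flip)
open import Relation.Binary using (tri<; tri≈; tri>)
open import Relation.Binary.PropositionalEquality
  using (_≡_; _≢_; refl; sym; trans; cong; cong₂; subst; subst₂; module ≡-Reasoning)
open import Relation.Nullary using (¬_; yes; no; contradiction)
open import Relation.Nullary.Decidable using (_×-dec_)
open import Relation.Unary using (Decidable)

private
  variable
    n m i j ℓ : ℕ
    e u v x y : Fin n
    p q : Subset n
    A B C D I J S T X Y Z : Subset n

x∈p─q⇒x∉q : x ∈ p ─ q → x ∉ q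
x∈p─q⇒x∉q {p = inside ∷ p} {q = outside ∷ q} here = λ ()
x∈p─q⇒x∉q {p = _ ∷ p} {q = _ ∷ q} (there x∈p─q) (there x∈q) = x∈p─q⇒x∉q x∈p─q x∈q

x∈p-y⇒x≢y : x ∈ p - y → x ≢ y
x∈p-y⇒x≢y = x∉⁅y⁆⇒x≢y ∘ x∈p─q⇒x∉q

∣p∣≡∣p∩q∣+∣p─q∣ : ∀ (p q : Subset n) → ∣ p ∣ ≡ ∣ p ∩ q ∣ + ∣ p ─ q ∣
∣p∣≡∣p∩q∣+∣p─q∣ [] [] = refl
∣p∣≡∣p∩q∣+∣p─q∣ (inside ∷ p) (inside ∷ q) = cong suc (∣p∣≡∣p∩q∣+∣p─q∣ p q)
∣p∣≡∣p∩q∣+∣p─q∣ (inside ∷ p) (outside ∷ q) = trans (cong suc (∣p∣≡∣p∩q∣+∣p─q∣ p q)) (sym (+-suc _ _))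
∣p∣≡∣p∩q∣+∣p─q∣ (outside ∷ p) (inside ∷ q) = ∣p∣≡∣p∩q∣+∣p─q∣ p q
∣p∣≡∣p∩q∣+∣p─q∣ (outside ∷ p) (outside ∷ q) = ∣p∣≡∣p∩q∣+∣p─q∣ p q

x∈p⇒∣p∣≡1+∣p-x∣ : x ∈ p → ∣ p ∣ ≡ suc ∣ p - x ∣
x∈p⇒∣p∣≡1+∣p-x∣ {p = inside ∷ p} here = cong (suc ∘ ∣_∣) (sym (p─⊥≡p p))
x∈p⇒∣p∣≡1+∣p-x∣ {p = inside ∷ p} (there x∈p) = cong suc (x∈p⇒∣p∣≡1+∣p-x∣ x∈p)
x∈p⇒∣p∣≡1+∣p-x∣ {p = outside ∷ p} (there x∈p) = x∈p⇒∣p∣≡1+∣p-x∣ x∈p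

x∉p⇒∣p∪⁅x⁆∣≡1+∣p∣ : x ∉ p → ∣ p ∪ ⁅ x ⁆ ∣ ≡ suc ∣ p ∣
x∉p⇒∣p∪⁅x⁆∣≡1+∣p∣ {x = zero} {p = inside ∷ p} x∉p = contradiction here x∉p
x∉p⇒∣p∪⁅x⁆∣≡1+∣p∣ {x = zero} {p = outside ∷ p} _ = cong (suc ∘ ∣_∣) (∪-identityʳ p)
x∉p⇒∣p∪⁅x⁆∣≡1+∣p∣ {x = suc x} {p = inside ∷ p} x∉p = cong suc (x∉p⇒∣p∪⁅x⁆∣≡1+∣p∣ (x∉p ∘ there))
x∉p⇒∣p∪⁅x⁆∣≡1+∣p∣ {x = suc x} {p = outside ∷ p} x∉p = x∉p⇒∣p∪⁅x⁆∣≡1+∣p∣ (x∉p ∘ there)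

∣p∣≡suc⇒nonempty : ∀ {m} → ∣ p ∣ ≡ suc m → Nonempty p
∣p∣≡suc⇒nonempty {n} {p} ∣p∣≡1+m with nonempty? p
... | yes ne = ne
... | no empty = contradiction (trans (sym ∣p∣≡1+m) (trans (cong ∣_∣ (Empty-unique empty)) (∣⊥∣≡0 n))) λ ()

△-assoc : ∀ (p q r : Subset n) → (p △ q) △ r ≡ p △ (q △ r)
△-assoc = zipWith-assoc xor-assoc

△-comm : ∀ (p q : Subset n) → p △ q ≡ q △ p
△-comm = zipWith-comm xor-comm

p△⊥≡p : ∀ (p : Subset n) → p △ ⊥ ≡ p
p△⊥≡p = zipWith-identityʳ xor-identityʳ

x∈p⇒p△⁅x⁆≡p-x : x ∈ p → p △ ⁅ x ⁆ ≡ p - x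
x∈p⇒p△⁅x⁆≡p-x {p = inside ∷ p} here = cong (outside ∷_) (trans (p△⊥≡p p) (sym (p─⊥≡p p)))
x∈p⇒p△⁅x⁆≡p-x {p = inside ∷ p} (there x∈p) = cong (inside ∷_) (x∈p⇒p△⁅x⁆≡p-x x∈p)
x∈p⇒p△⁅x⁆≡p-x {p = outside ∷ p} (there x∈p) = cong (outside ∷_) (x∈p⇒p△⁅x⁆≡p-x x∈p)

x∉p⇒p△⁅x⁆≡p∪⁅x⁆ : x ∉ p → p △ ⁅ x ⁆ ≡ p ∪ ⁅ x ⁆
x∉p⇒p△⁅x⁆≡p∪⁅x⁆ {x = zero} {p = inside ∷ p} x∉p = contradiction here x∉p
x∉p⇒p△⁅x⁆≡p∪⁅x⁆ {x = zero} {p = outside ∷ p} _ = cong (inside ∷_) (trans (p△⊥≡p p) (sym (∪-identityʳ p)))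
x∉p⇒p△⁅x⁆≡p∪⁅x⁆ {x = suc x} {p = inside ∷ p} x∉p = cong (inside ∷_) (x∉p⇒p△⁅x⁆≡p∪⁅x⁆ (x∉p ∘ there))
x∉p⇒p△⁅x⁆≡p∪⁅x⁆ {x = suc x} {p = outside ∷ p} x∉p = cong (outside ∷_) (x∉p⇒p△⁅x⁆≡p∪⁅x⁆ (x∉p ∘ there))

x≢y⇒⁅x⁆∪⁅y⁆≡⁅x⁆△⁅y⁆ : x ≢ y → ⁅ x ⁆ ∪ ⁅ y ⁆ ≡ ⁅ x ⁆ △ ⁅ y ⁆
x≢y⇒⁅x⁆∪⁅y⁆≡⁅x⁆△⁅y⁆ {x = zero} {zero} x≢y = contradiction refl x≢y
x≢y⇒⁅x⁆∪⁅y⁆≡⁅x⁆△⁅y⁆ {x = zero} {suc y} _ =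
  cong (inside ∷_) (trans (∪-identityˡ _) (sym (zipWith-identityˡ xor-identityˡ _)))
x≢y⇒⁅x⁆∪⁅y⁆≡⁅x⁆△⁅y⁆ {x = suc x} {zero} _ = cong (inside ∷_) (trans (∪-identityʳ _) (sym (p△⊥≡p _)))
x≢y⇒⁅x⁆∪⁅y⁆≡⁅x⁆△⁅y⁆ {x = suc x} {suc y} x≢y = cong (outside ∷_) (x≢y⇒⁅x⁆∪⁅y⁆≡⁅x⁆△⁅y⁆ (x≢y ∘ cong suc))

x∈p∧x∉q⇒x∈p△q : x ∈ p → x ∉ q → x ∈ p △ q
x∈p∧x∉q⇒x∈p△q {q = inside ∷ q} here x∉q = contradiction here x∉q
x∈p∧x∉q⇒x∈p△q {q = outside ∷ q} here _ = here
x∈p∧x∉q⇒x∈p△q {q = _ ∷ q} (there x∈p) x∉q = there (x∈p∧x∉q⇒x∈p△q x∈p (x∉q ∘ there))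

x∉p∧x∈q⇒x∈p△q : x ∉ p → x ∈ q → x ∈ p △ q
x∉p∧x∈q⇒x∈p△q {p = p} {q} x∉p x∈q = subst (_ ∈_) (△-comm q p) (x∈p∧x∉q⇒x∈p△q x∈q x∉p)

x≢y⇒p△⁅x⁆∪⁅y⁆≡p△⁅x⁆△⁅y⁆ : ∀ (p : Subset n) → x ≢ y → p △ (⁅ x ⁆ ∪ ⁅ y ⁆) ≡ (p △ ⁅ x ⁆) △ ⁅ y ⁆
x≢y⇒p△⁅x⁆∪⁅y⁆≡p△⁅x⁆△⁅y⁆ {x = x} {y} p x≢y =
  trans (cong (p △_) (x≢y⇒⁅x⁆∪⁅y⁆≡⁅x⁆△⁅y⁆ x≢y)) (sym (△-assoc p ⁅ x ⁆ ⁅ y ⁆))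

x∈p△q⇒[p△⁅x⁆]△q≡[p△q]-x : ∀ (p q : Subset n) → x ∈ p △ q → (p △ ⁅ x ⁆) △ q ≡ (p △ q) - x
x∈p△q⇒[p△⁅x⁆]△q≡[p△q]-x {x = x} p q x∈p△q = begin
  (p △ ⁅ x ⁆) △ q  ≡⟨ △-assoc p ⁅ x ⁆ q ⟩
  p △ (⁅ x ⁆ △ q)  ≡⟨ cong (p △_) (△-comm ⁅ x ⁆ q) ⟩
  p △ (q △ ⁅ x ⁆)  ≡⟨ △-assoc p q ⁅ x ⁆ ⟨
  (p △ q) △ ⁅ x ⁆  ≡⟨ x∈p⇒p△⁅x⁆≡p-x x∈p△q ⟩
  (p △ q) - x      ∎
  where open ≡-Reasoning

toggle-toward : x ∈ p △ q → y ∈ (p △ ⁅ x ⁆) △ q → y ∈ p △ q × p △ (⁅ x ⁆ ∪ ⁅ y ⁆) ≡ (p △ ⁅ x ⁆) △ ⁅ y ⁆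
toggle-toward {x = x} {p} {q} {y} x∈p△q y∈[p△⁅x⁆]△q =
  p─q⊆p _ _ y∈[p△q]-x , x≢y⇒p△⁅x⁆∪⁅y⁆≡p△⁅x⁆△⁅y⁆ p (x∈p-y⇒x≢y y∈[p△q]-x ∘ sym)
  where
  y∈[p△q]-x : y ∈ (p △ q) - x
  y∈[p△q]-x = subst (_ ∈_) (x∈p△q⇒[p△⁅x⁆]△q≡[p△q]-x p q x∈p△q) y∈[p△⁅x⁆]△q

p⊆[p∩q]∪[p─q] : ∀ (p q : Subset n) → p ⊆ (p ∩ q) ∪ (p ─ q)
p⊆[p∩q]∪[p─q] p q {x} x∈p with x ∈? q
... | yes x∈q = x∈p∪q⁺ (inj₁ (x∈p∩q⁺ (x∈p , x∈q)))
... | no x∉q = x∈p∪q⁺ (inj₂ (x∈p∧x∉q⇒x∈p─q x∈p x∉q))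

p⊆[p-x]∪⁅x⁆ : ∀ (p : Subset n) x → p ⊆ (p - x) ∪ ⁅ x ⁆
p⊆[p-x]∪⁅x⁆ p x {y} y∈p with y ≟ x
... | yes refl = x∈p∪q⁺ (inj₂ (x∈⁅x⁆ x))
... | no y≢x = x∈p∪q⁺ (inj₁ (x∈p∧x≢y⇒x∈p-y y∈p y≢x))

p⊆q⇒p∪q≡q : A ⊆ B → A ∪ B ≡ B
p⊆q⇒p∪q≡q {A = A} {B} A⊆B = ⊆-antisym (λ x∈ → [ A⊆B , id ]′ (x∈p∪q⁻ A B x∈)) (q⊆p∪q A B)

p⊆q⇒p∩q≡p : A ⊆ B → A ∩ B ≡ A
p⊆q⇒p∩q≡p {A = A} {B} A⊆B = ⊆-antisym (p∩q⊆p A B) (λ x∈A → x∈p∩q⁺ (x∈A , A⊆B x∈A))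

⊥++p⊆q++p : ∀ (q : Subset n) {p : Subset m} → ⊥ ++ p ⊆ q ++ p
⊥++p⊆q++p []      x∈ = x∈
⊥++p⊆q++p (_ ∷ q) (there x∈) = there (⊥++p⊆q++p q x∈)

Independent : Matroid n → Subset n → Set
Independent M A = rank M A ≡ ∣ A ∣

Spanning : Matroid n → Subset n → Set
Spanning M A = rank M A ≡ r M

module _ (M : Matroid n) where

  rank-⊥ : rank M ⊥ ≡ 0
  rank-⊥ = n≤0⇒n≡0 (subst (rank M ⊥ ≤_) (∣⊥∣≡0 n) (rank-≤ M ⊥))

  rank≤r : ∀ A → rank M A ≤ r M
  rank≤r A = rank-mono M ⊆⊤

  submodular-⊆ : C ⊆ A ∪ B → D ⊆ A ∩ B → rank M C + rank M D ≤ rank M A + rank M B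
  submodular-⊆ {A = A} {B} C⊆A∪B D⊆A∩B =
    ≤-trans (+-mono-≤ (rank-mono M C⊆A∪B) (rank-mono M D⊆A∩B)) (rank-sub M A B)

  subadditive-⊆ : C ⊆ A ∪ B → rank M C ≤ rank M A + rank M B
  subadditive-⊆ C⊆A∪B = ≤-trans (m≤m+n _ _) (submodular-⊆ C⊆A∪B ⊥⊆)

  rank-∪⁅⁆ : ∀ A e → rank M (A ∪ ⁅ e ⁆) ≤ suc (rank M A)
  rank-∪⁅⁆ A e = begin
    rank M (A ∪ ⁅ e ⁆)        ≤⟨ subadditive-⊆ id ⟩
    rank M A + rank M ⁅ e ⁆   ≤⟨ +-monoʳ-≤ (rank M A) (subst (rank M ⁅ e ⁆ ≤_) (∣⁅x⁆∣≡1 e) (rank-≤ M ⁅ e ⁆)) ⟩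
    rank M A + 1              ≡⟨ +-comm (rank M A) 1 ⟩
    suc (rank M A)            ∎
    where open ≤-Reasoning

  spanning-⊆ : A ⊆ B → Spanning M A → Spanning M B
  spanning-⊆ {A = A} {B} A⊆B A-span = ≤-antisym (rank≤r B) (subst (_≤ rank M B) A-span (rank-mono M A⊆B))

  independent-⊆ : A ⊆ I → Independent M I → Independent M A
  independent-⊆ {A = A} {I} A⊆I I-indep = ≤-antisym (rank-≤ M A) (+-cancelʳ-≤ ∣ I ─ A ∣ _ _ (begin
    ∣ A ∣ + ∣ I ─ A ∣                 ≤⟨ +-monoˡ-≤ _ (p⊆q⇒∣p∣≤∣q∣ (λ x∈A → x∈p∩q⁺ (A⊆I x∈A , x∈A))) ⟩
    ∣ I ∩ A ∣ + ∣ I ─ A ∣             ≡⟨ ∣p∣≡∣p∩q∣+∣p─q∣ I A ⟨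
    ∣ I ∣                             ≡⟨ I-indep ⟨
    rank M I                          ≤⟨ subadditive-⊆ (p⊆[p∩q]∪[p─q] I A) ⟩
    rank M (I ∩ A) + rank M (I ─ A)   ≤⟨ +-mono-≤ (rank-mono M (p∩q⊆q I A)) (rank-≤ M (I ─ A)) ⟩
    rank M A + ∣ I ─ A ∣              ∎))
    where open ≤-Reasoning

  rank<rank∪⁅⁆⇒∉ : rank M A < rank M (A ∪ ⁅ e ⁆) → e ∉ A
  rank<rank∪⁅⁆⇒∉ {A = A} rA<rA+e e∈A = <⇒≱ rA<rA+e (rank-mono M A+e⊆A)
    where
    A+e⊆A : A ∪ ⁅ _ ⁆ ⊆ A
    A+e⊆A x∈ with x∈p∪q⁻ A _ x∈
    ... | inj₁ x∈A = x∈A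
    ... | inj₂ x∈⁅e⁆ rewrite x∈⁅y⁆⇒x≡y _ x∈⁅e⁆ = e∈A

  independent-∪⁅⁆ : Independent M I → rank M I < rank M (I ∪ ⁅ e ⁆) → Independent M (I ∪ ⁅ e ⁆)
  independent-∪⁅⁆ {I = I} {e} I-indep rI<rI+e = ≤-antisym (rank-≤ M _) (begin
    ∣ I ∪ ⁅ e ⁆ ∣   ≡⟨ x∉p⇒∣p∪⁅x⁆∣≡1+∣p∣ (rank<rank∪⁅⁆⇒∉ rI<rI+e) ⟩
    suc ∣ I ∣       ≡⟨ cong suc I-indep ⟨
    suc (rank M I)  ≤⟨ rI<rI+e ⟩
    rank M (I ∪ ⁅ e ⁆) ∎)
    where open ≤-Reasoning

  rank-∪-spanned : (∀ {e} → e ∈ S → rank M (I ∪ ⁅ e ⁆) ≤ rank M I) → rank M (I ∪ S) ≤ rank M I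
  rank-∪-spanned {I = I} = go _ refl
    where
    go : ∀ m {S} → ∣ S ∣ ≡ m → (∀ {e} → e ∈ S → rank M (I ∪ ⁅ e ⁆) ≤ rank M I) →
         rank M (I ∪ S) ≤ rank M I
    go zero {S} ∣S∣≡0 _ = rank-mono M I∪S⊆I
      where
      I∪S⊆I : I ∪ S ⊆ I
      I∪S⊆I x∈ with x∈p∪q⁻ I S x∈
      ... | inj₁ x∈I = x∈I
      ... | inj₂ x∈S = contradiction (subst (∣ S - _ ∣ <_) ∣S∣≡0 (x∈p⇒∣p-x∣<∣p∣ x∈S)) λ ()
    go (suc m) {S} ∣S∣≡1+m closed with ∣p∣≡suc⇒nonempty ∣S∣≡1+m
    ... | e , e∈S = +-cancelʳ-≤ (rank M I) _ _ (begin
      rank M (I ∪ S) + rank M I                  ≤⟨ submodular-⊆ cover (λ x∈I → x∈p∩q⁺ (p⊆p∪q _ x∈I , p⊆p∪q _ x∈I)) ⟩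
      rank M (I ∪ (S - e)) + rank M (I ∪ ⁅ e ⁆)  ≤⟨ +-mono-≤ (go m ∣S-e∣≡m (closed ∘ p─q⊆p S _)) (closed e∈S) ⟩
      rank M I + rank M I                        ∎)
      where
      open ≤-Reasoning
      ∣S-e∣≡m : ∣ S - e ∣ ≡ m
      ∣S-e∣≡m = suc-injective (trans (sym (x∈p⇒∣p∣≡1+∣p-x∣ e∈S)) ∣S∣≡1+m)
      cover : I ∪ S ⊆ (I ∪ (S - e)) ∪ (I ∪ ⁅ e ⁆)
      cover {x} x∈ with x∈p∪q⁻ I S x∈ | x ≟ e
      ... | inj₁ x∈I | _        = p⊆p∪q _ (p⊆p∪q _ x∈I)
      ... | inj₂ _   | yes refl = q⊆p∪q _ _ (q⊆p∪q I _ (x∈⁅x⁆ x))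
      ... | inj₂ x∈S | no x≢e   = p⊆p∪q _ (q⊆p∪q I _ (x∈p∧x≢y⇒x∈p-y x∈S x≢e))

  rank-increase : rank M I < rank M S → ∃[ e ] e ∈ S × rank M I < rank M (I ∪ ⁅ e ⁆)
  rank-increase {I = I} {S} rI<rS with any? (λ e → e ∈? S ×-dec rank M I <? rank M (I ∪ ⁅ e ⁆))
  ... | yes found = found
  ... | no none = contradiction (≤-trans (rank-mono M (q⊆p∪q I S)) (rank-∪-spanned closed)) (<⇒≱ rI<rS)
    where
    closed : ∀ {e} → e ∈ S → rank M (I ∪ ⁅ e ⁆) ≤ rank M I
    closed e∈S = ≮⇒≥ λ rI<rI+e → none (_ , e∈S , rI<rI+e)

  nonspanning-increase : Spanning M S → ¬ Spanning M A → ∃[ e ] e ∈ S × rank M A < rank M (A ∪ ⁅ e ⁆)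
  nonspanning-increase {A = A} S-span ¬A-span =
    rank-increase (subst (rank M A <_) (sym S-span) (≤∧≢⇒< (rank≤r A) ¬A-span))

  augment : Independent M I → Independent M J → ∣ I ∣ < ∣ J ∣ →
            ∃[ e ] e ∈ J × e ∉ I × Independent M (I ∪ ⁅ e ⁆)
  augment I-indep J-indep ∣I∣<∣J∣ with rank-increase (subst₂ _<_ (sym I-indep) (sym J-indep) ∣I∣<∣J∣)
  ... | e , e∈J , rI<rI+e = e , e∈J , rank<rank∪⁅⁆⇒∉ rI<rI+e , independent-∪⁅⁆ I-indep rI<rI+e

  extend : ∀ d → Independent M I → ∣ I ∣ + d ≤ r M → ∃[ J ] I ⊆ J × Independent M J × ∣ J ∣ ≡ ∣ I ∣ + d
  extend zero I-indep _ = _ , id , I-indep , sym (+-identityʳ _)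
  extend {I = I} (suc d) I-indep ∣I∣+1+d≤r
    with rank-increase (subst (_< r M) (sym I-indep) (≤-trans (m<m+n ∣ I ∣ z<s) ∣I∣+1+d≤r))
  ... | e , _ , rI<rI+e =
    let J , I+e⊆J , J-indep , ∣J∣≡∣I+e∣+d = extend d (independent-∪⁅⁆ I-indep rI<rI+e) ∣I+e∣+d≤r
    in  J , I+e⊆J ∘ p⊆p∪q _ , J-indep , trans ∣J∣≡∣I+e∣+d ∣I+e∣+d≡∣I∣+1+d
    where
    ∣I+e∣+d≡∣I∣+1+d : ∣ I ∪ ⁅ e ⁆ ∣ + d ≡ ∣ I ∣ + suc d
    ∣I+e∣+d≡∣I∣+1+d = trans (cong (_+ d) (x∉p⇒∣p∪⁅x⁆∣≡1+∣p∣ (rank<rank∪⁅⁆⇒∉ rI<rI+e))) (sym (+-suc ∣ I ∣ d))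
    ∣I+e∣+d≤r : ∣ I ∪ ⁅ e ⁆ ∣ + d ≤ r M
    ∣I+e∣+d≤r = subst (_≤ r M) (sym ∣I+e∣+d≡∣I∣+1+d) ∣I∣+1+d≤r

  basis-exists : ∃[ B ] Independent M B × ∣ B ∣ ≡ r M
  basis-exists =
    let B , _ , B-indep , ∣B∣≡∣⊥∣+r = extend (r M) ⊥-indep (≤-reflexive ∣⊥∣+r≡r)
    in  B , B-indep , trans ∣B∣≡∣⊥∣+r ∣⊥∣+r≡r
    where
    ⊥-indep : Independent M ⊥
    ⊥-indep = trans rank-⊥ (sym (∣⊥∣≡0 n))
    ∣⊥∣+r≡r : ∣ ⊥ {n} ∣ + r M ≡ r M
    ∣⊥∣+r≡r = cong (_+ r M) (∣⊥∣≡0 n)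

  coloop-raises-rank : e ∈ D ─ S → rank M (D - e) < rank M D → rank M (D ∩ S) < rank M (D ∩ (S ∪ ⁅ e ⁆))
  coloop-raises-rank {e = e} {D} {S} e∈D─S coloop = +-cancelʳ-≤ (rank M (D - e)) _ _ (begin
    suc (rank M (D ∩ S)) + rank M (D - e)        ≡⟨ +-suc _ _ ⟨
    rank M (D ∩ S) + suc (rank M (D - e))        ≤⟨ +-monoʳ-≤ _ coloop ⟩
    rank M (D ∩ S) + rank M D                    ≡⟨ +-comm (rank M (D ∩ S)) (rank M D) ⟩
    rank M D + rank M (D ∩ S)                    ≤⟨ submodular-⊆ cover inner ⟩
    rank M (D ∩ (S ∪ ⁅ e ⁆)) + rank M (D - e)    ∎)
    where
    open ≤-Reasoning
    cover : D ⊆ (D ∩ (S ∪ ⁅ e ⁆)) ∪ (D - e)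
    cover {x} x∈D with x ≟ e
    ... | yes refl = x∈p∪q⁺ (inj₁ (x∈p∩q⁺ (x∈D , q⊆p∪q S _ (x∈⁅x⁆ x))))
    ... | no x≢e   = x∈p∪q⁺ (inj₂ (x∈p∧x≢y⇒x∈p-y x∈D x≢e))
    inner : D ∩ S ⊆ (D ∩ (S ∪ ⁅ e ⁆)) ∩ (D - e)
    inner x∈D∩S with x∈p∩q⁻ D S x∈D∩S
    ... | x∈D , x∈S = x∈p∩q⁺ (x∈p∩q⁺ (x∈D , p⊆p∪q _ x∈S) , x∈p∧x≢y⇒x∈p-y x∈D λ { refl → x∈p─q⇒x∉q e∈D─S x∈S })

  rank-coloops : (∀ {v} → v ∈ D ─ S → rank M (D - v) < rank M D) → rank M (D ∩ S) + ∣ D ─ S ∣ ≤ rank M D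
  rank-coloops {D = D} = go _ refl
    where
    go : ∀ m {S} → ∣ D ─ S ∣ ≡ m → (∀ {v} → v ∈ D ─ S → rank M (D - v) < rank M D) →
         rank M (D ∩ S) + ∣ D ─ S ∣ ≤ rank M D
    go zero {S} ∣D─S∣≡0 _ = begin
      rank M (D ∩ S) + ∣ D ─ S ∣  ≡⟨ cong (rank M (D ∩ S) +_) ∣D─S∣≡0 ⟩
      rank M (D ∩ S) + 0          ≡⟨ +-identityʳ _ ⟩
      rank M (D ∩ S)              ≤⟨ rank-mono M (p∩q⊆p D S) ⟩
      rank M D                    ∎
      where open ≤-Reasoning
    go (suc m) {S} ∣D─S∣≡1+m coloops with ∣p∣≡suc⇒nonempty ∣D─S∣≡1+m
    ... | e , e∈D─S = begin
      rank M (D ∩ S) + ∣ D ─ S ∣          ≡⟨ cong (rank M (D ∩ S) +_) ∣D─S∣≡1+∣D─S'∣ ⟩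
      rank M (D ∩ S) + suc ∣ D ─ S' ∣     ≡⟨ +-suc _ _ ⟩
      suc (rank M (D ∩ S)) + ∣ D ─ S' ∣   ≤⟨ +-monoˡ-≤ _ (coloop-raises-rank e∈D─S (coloops e∈D─S)) ⟩
      rank M (D ∩ S') + ∣ D ─ S' ∣        ≤⟨ go m ∣D─S'∣≡m (coloops ∘ D─S'⊆D─S) ⟩
      rank M D                            ∎
      where
      open ≤-Reasoning
      S' : Subset _
      S' = S ∪ ⁅ e ⁆
      D─S'≡[D─S]-e : D ─ S' ≡ (D ─ S) - e
      D─S'≡[D─S]-e = sym (p─q─r≡p─q∪r D S ⁅ e ⁆)
      ∣D─S∣≡1+∣D─S'∣ : ∣ D ─ S ∣ ≡ suc ∣ D ─ S' ∣
      ∣D─S∣≡1+∣D─S'∣ = trans (x∈p⇒∣p∣≡1+∣p-x∣ e∈D─S) (cong (suc ∘ ∣_∣) (sym D─S'≡[D─S]-e))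
      ∣D─S'∣≡m : ∣ D ─ S' ∣ ≡ m
      ∣D─S'∣≡m = suc-injective (trans (sym ∣D─S∣≡1+∣D─S'∣) ∣D─S∣≡1+m)
      D─S'⊆D─S : D ─ S' ⊆ D ─ S
      D─S'⊆D─S = p─q⊆p (D ─ S) ⁅ e ⁆ ∘ subst (_ ∈_) D─S'≡[D─S]-e

  non-coloop : rank M D < rank M (D ∩ S) + ∣ D ─ S ∣ → ∃[ v ] v ∈ D ─ S × rank M D ≤ rank M (D - v)
  non-coloop {D = D} {S} rD< with any? (λ v → v ∈? D ─ S ×-dec rank M D ≤? rank M (D - v))
  ... | yes found = found
  ... | no none = contradiction (rank-coloops coloops) (<⇒≱ rD<)
    where
    coloops : ∀ {v} → v ∈ D ─ S → rank M (D - v) < rank M D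
    coloops v∈D─S = ≰⇒> λ rD≤rD-v → none (_ , v∈D─S , rD≤rD-v)

  dual-augment : Spanning M S → Spanning M T → ∣ T ∣ < ∣ S ∣ → ∃[ v ] v ∈ S × v ∉ T × Spanning M (S - v)
  dual-augment {S = S} {T} S-span T-span ∣T∣<∣S∣ =
    let v , v∈S─T , rS≤rS-v = non-coloop rS<
    in  v , p─q⊆p S T v∈S─T , x∈p─q⇒x∉q v∈S─T , ≤-antisym (rank≤r (S - v)) (subst (_≤ rank M (S - v)) S-span rS≤rS-v)
    where
    open ≤-Reasoning
    ∣T─S∣<∣S─T∣ : ∣ T ─ S ∣ < ∣ S ─ T ∣
    ∣T─S∣<∣S─T∣ = +-cancelˡ-< ∣ S ∩ T ∣ _ _ (begin-strict
      ∣ S ∩ T ∣ + ∣ T ─ S ∣  ≡⟨ cong (λ U → ∣ U ∣ + ∣ T ─ S ∣) (∩-comm S T) ⟩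
      ∣ T ∩ S ∣ + ∣ T ─ S ∣  ≡⟨ ∣p∣≡∣p∩q∣+∣p─q∣ T S ⟨
      ∣ T ∣                  <⟨ ∣T∣<∣S∣ ⟩
      ∣ S ∣                  ≡⟨ ∣p∣≡∣p∩q∣+∣p─q∣ S T ⟩
      ∣ S ∩ T ∣ + ∣ S ─ T ∣  ∎)
    rS< : rank M S < rank M (S ∩ T) + ∣ S ─ T ∣
    rS< = begin-strict
      rank M S                         ≡⟨ trans S-span (sym T-span) ⟩
      rank M T                         ≤⟨ subadditive-⊆ (p⊆[p∩q]∪[p─q] T S) ⟩
      rank M (T ∩ S) + rank M (T ─ S)  ≡⟨ cong (λ U → rank M U + rank M (T ─ S)) (∩-comm T S) ⟩
      rank M (S ∩ T) + rank M (T ─ S)  ≤⟨ +-monoʳ-≤ _ (rank-≤ M (T ─ S)) ⟩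
      rank M (S ∩ T) + ∣ T ─ S ∣       <⟨ +-monoʳ-< _ ∣T─S∣<∣S─T∣ ⟩
      rank M (S ∩ T) + ∣ S ─ T ∣       ∎

  dependent-non-coloop : Independent M Y → ¬ Independent M D → ∃[ v ] v ∈ D ─ Y × rank M D ≤ rank M (D - v)
  dependent-non-coloop {Y = Y} {D} Y-indep ¬D-indep = non-coloop (begin-strict
    rank M D                    <⟨ ≤∧≢⇒< (rank-≤ M D) ¬D-indep ⟩
    ∣ D ∣                       ≡⟨ ∣p∣≡∣p∩q∣+∣p─q∣ D Y ⟩
    ∣ D ∩ Y ∣ + ∣ D ─ Y ∣       ≡⟨ cong (_+ ∣ D ─ Y ∣) (independent-⊆ (p∩q⊆q D Y) Y-indep) ⟨
    rank M (D ∩ Y) + ∣ D ─ Y ∣  ∎)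
    where open ≤-Reasoning

-- M / X has rank A ↦ r(A ∪ X) − r(X) and M \ X has rank A ↦ r(A); the inequality is
-- submodularity of M on A ∪ X and B.
contraction-deletion-inequality : ∀ (M : Matroid (n + m)) {A B : Subset n} → A ⊆ B →
  (rank M (B ++ ⊤ {m}) ∸ rank M (⊥ ++ ⊤ {m})) + rank M (A ++ ⊥ {m})
    ≤ (rank M (A ++ ⊤ {m}) ∸ rank M (⊥ ++ ⊤ {m})) + rank M (B ++ ⊥ {m})
contraction-deletion-inequality {m = m} M {A} {B} A⊆B = begin
  (ρ (B ++ ⊤ₘ) ∸ ρX) + ρ (A ++ ⊥ₘ)  ≡⟨ +-∸-comm _ (rank-mono M (⊥++p⊆q++p B)) ⟨
  (ρ (B ++ ⊤ₘ) + ρ (A ++ ⊥ₘ)) ∸ ρX  ≤⟨ ∸-monoˡ-≤ ρX submodular ⟩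
  (ρ (A ++ ⊤ₘ) + ρ (B ++ ⊥ₘ)) ∸ ρX  ≡⟨ +-∸-comm _ (rank-mono M (⊥++p⊆q++p A)) ⟩
  (ρ (A ++ ⊤ₘ) ∸ ρX) + ρ (B ++ ⊥ₘ)  ∎
  where
  open ≤-Reasoning
  ⊤ₘ ⊥ₘ : Subset m
  ⊤ₘ = ⊤
  ⊥ₘ = ⊥
  ρ : Subset (_ + m) → ℕ
  ρ = rank M
  ρX : ℕ
  ρX = ρ (⊥ ++ ⊤ₘ)
  submodular : ρ (B ++ ⊤ₘ) + ρ (A ++ ⊥ₘ) ≤ ρ (A ++ ⊤ₘ) + ρ (B ++ ⊥ₘ)
  submodular = subst₂ (λ U V → ρ U + ρ V ≤ ρ (A ++ ⊤ₘ) + ρ (B ++ ⊥ₘ))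
    (trans (zipWith-++ _ A ⊤ₘ B ⊥ₘ) (cong₂ _++_ (p⊆q⇒p∪q≡q A⊆B) (∪-zeroˡ ⊥ₘ)))
    (trans (zipWith-++ _ A ⊤ₘ B ⊥ₘ) (cong₂ _++_ (p⊆q⇒p∩q≡p A⊆B) (∩-zeroʳ ⊤ₘ)))
    (rank-sub M (A ++ ⊤ₘ) (B ++ ⊥ₘ))

record IsLiftBasis (Q L : Matroid n) (ℓ : ℕ) (B : Subset n) : Set where
  constructor liftBasis
  field
    independent : Independent L B
    spanning    : Spanning Q B
    size        : ∣ B ∣ ≡ r Q + ℓ

open IsLiftBasis using (independent; spanning)

module _ {Q L : Matroid n} where

  lift-bound : IsLiftBasis Q L ℓ B → r Q + ℓ ≤ r L
  lift-bound {B = B} (liftBasis B-indep _ ∣B∣) = subst (_≤ r L) (trans B-indep ∣B∣) (rank≤r L B)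

  spanning⇒liftBasis : Independent L B → Spanning Q B → IsLiftBasis Q L (∣ B ∣ ∸ r Q) B
  spanning⇒liftBasis {B = B} B-indep B-span =
    liftBasis B-indep B-span (sym (m+[n∸m]≡n (subst (_≤ ∣ B ∣) B-span (rank-≤ Q B))))

  liftBasis⇒higgsBasis : IsLiftBasis Q L ℓ B → IsBasisOf (higgsRank Q L ℓ) B
  liftBasis⇒higgsBasis {ℓ = ℓ} {B} lb@(liftBasis B-indep B-span ∣B∣) = ρB≡∣B∣ , (begin
    (rank Q B + ℓ) ⊓ rank L B  ≡⟨ ρB≡∣B∣ ⟩
    ∣ B ∣                      ≡⟨ ∣B∣ ⟩
    r Q + ℓ                    ≡⟨ m≤n⇒m⊓n≡m (lift-bound lb) ⟨
    (r Q + ℓ) ⊓ r L            ∎)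
    where
    open ≡-Reasoning
    ρB≡∣B∣ : (rank Q B + ℓ) ⊓ rank L B ≡ ∣ B ∣
    ρB≡∣B∣ = begin
      (rank Q B + ℓ) ⊓ rank L B  ≡⟨ cong₂ _⊓_ (cong (_+ ℓ) B-span) B-indep ⟩
      (r Q + ℓ) ⊓ ∣ B ∣          ≡⟨ cong (_⊓ ∣ B ∣) ∣B∣ ⟨
      ∣ B ∣ ⊓ ∣ B ∣              ≡⟨ ⊓-idem ∣ B ∣ ⟩
      ∣ B ∣                      ∎

  higgsBasis⇒liftBasis : r Q + ℓ ≤ r L → IsBasisOf (higgsRank Q L ℓ) B → IsLiftBasis Q L ℓ B
  higgsBasis⇒liftBasis {ℓ = ℓ} {B} rQ+ℓ≤rL (ρB≡∣B∣ , ρB≡ρ⊤) = liftBasis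
    (≤-antisym (rank-≤ L B) (subst (_≤ rank L B) ρB≡∣B∣ (m⊓n≤n _ _)))
    (≤-antisym (rank≤r Q B) (+-cancelʳ-≤ ℓ _ _ (subst (_≤ rank Q B + ℓ) ρB≡rQ+ℓ (m⊓n≤m _ _))))
    (trans (sym ρB≡∣B∣) ρB≡rQ+ℓ)
    where
    ρB≡rQ+ℓ : higgsRank Q L ℓ B ≡ r Q + ℓ
    ρB≡rQ+ℓ = trans ρB≡ρ⊤ (m≤n⇒m⊓n≡m rQ+ℓ≤rL)

  lift-augment : IsLiftBasis Q L ℓ Z → IsLiftBasis Q L j Y → ℓ < j →
                 ∃[ v ] v ∈ Z △ Y × IsLiftBasis Q L (suc ℓ) (Z △ ⁅ v ⁆)
  lift-augment {ℓ = ℓ} (liftBasis Z-indep Z-span ∣Z∣) (liftBasis Y-indep _ ∣Y∣) ℓ<j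
    with augment L Z-indep Y-indep (subst₂ _<_ (sym ∣Z∣) (sym ∣Y∣) (+-monoʳ-< (r Q) ℓ<j))
  ... | v , v∈Y , v∉Z , Z+v-indep = v , x∉p∧x∈q⇒x∈p△q v∉Z v∈Y ,
    subst (IsLiftBasis Q L (suc ℓ)) (sym (x∉p⇒p△⁅x⁆≡p∪⁅x⁆ v∉Z)) (liftBasis Z+v-indep (spanning-⊆ Q (p⊆p∪q _) Z-span)
      (trans (x∉p⇒∣p∪⁅x⁆∣≡1+∣p∣ v∉Z) (trans (cong suc ∣Z∣) (sym (+-suc (r Q) ℓ)))))

  lift-dual-augment : IsLiftBasis Q L (suc ℓ) Z → IsLiftBasis Q L j Y → j ≤ ℓ →
                      ∃[ v ] v ∈ Z △ Y × IsLiftBasis Q L ℓ (Z △ ⁅ v ⁆)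
  lift-dual-augment {ℓ = ℓ} (liftBasis Z-indep Z-span ∣Z∣) (liftBasis _ Y-span ∣Y∣) j≤ℓ
    with dual-augment Q Z-span Y-span (subst₂ _<_ (sym ∣Y∣) (sym ∣Z∣) (+-monoʳ-< (r Q) (s≤s j≤ℓ)))
  ... | v , v∈Z , v∉Y , Z-v-span = v , x∈p∧x∉q⇒x∈p△q v∈Z v∉Y ,
    subst (IsLiftBasis Q L ℓ) (sym (x∈p⇒p△⁅x⁆≡p-x v∈Z)) (liftBasis (independent-⊆ L (p─q⊆p _ _) Z-indep) Z-v-span
      (suc-injective (trans (sym (x∈p⇒∣p∣≡1+∣p-x∣ v∈Z)) (trans ∣Z∣ (+-suc (r Q) ℓ)))))

LevelIn : ∀ {k} → Subset (suc k) → ℕ → Set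
LevelIn K ℓ = ∃[ i ] i ∈ K × toℕ i ≡ ℓ

levelIn? : ∀ {k} (K : Subset (suc k)) → Decidable (LevelIn K)
levelIn? K ℓ = any? λ i → i ∈? K ×-dec toℕ i ≟ℕ ℓ

module HiggsLift (Q L : Matroid n) (quot : IsQuotient Q L) where

  quotient-inequality : A ⊆ B → rank Q B + rank L A ≤ rank Q A + rank L B
  quotient-inequality {A = A} {B} A⊆B =
    let _ , M , L≡M\X , Q≡M/X = quot
    in  subst₂ _≤_ (cong₂ _+_ (sym (Q≡M/X B)) (sym (L≡M\X A))) (cong₂ _+_ (sym (Q≡M/X A)) (sym (L≡M\X B)))
          (contraction-deletion-inequality M A⊆B)

  rank-Q≤rank-L : ∀ B → rank Q B ≤ rank L B
  rank-Q≤rank-L B = begin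
    rank Q B               ≡⟨ +-identityʳ _ ⟨
    rank Q B + 0           ≡⟨ cong (rank Q B +_) (rank-⊥ L) ⟨
    rank Q B + rank L ⊥    ≤⟨ quotient-inequality (⊥⊆ {p = B}) ⟩
    rank Q ⊥ + rank L B    ≡⟨ cong (_+ rank L B) (rank-⊥ Q) ⟩
    rank L B               ∎
    where open ≤-Reasoning

  rank-L-stable⇒rank-Q-stable : A ⊆ B → rank L B ≤ rank L A → rank Q B ≤ rank Q A
  rank-L-stable⇒rank-Q-stable A⊆B rLB≤rLA =
    +-cancelʳ-≤ _ _ _ (≤-trans (quotient-inequality A⊆B) (+-monoʳ-≤ _ rLB≤rLA))

  independent-Q⇒independent-L : Independent Q B → Independent L B
  independent-Q⇒independent-L {B = B} B-indep =
    ≤-antisym (rank-≤ L B) (subst (_≤ rank L B) B-indep (rank-Q≤rank-L B))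

  lift-basis-exists : r Q + ℓ ≤ r L → ∃[ B ] IsLiftBasis Q L ℓ B
  lift-basis-exists {ℓ = ℓ} rQ+ℓ≤rL =
    let B₀ , B₀-indep , ∣B₀∣≡rQ = basis-exists Q
        B , B₀⊆B , B-indep , ∣B∣≡∣B₀∣+ℓ = extend L ℓ (independent-Q⇒independent-L B₀-indep)
                                                     (subst (λ k → k + ℓ ≤ r L) (sym ∣B₀∣≡rQ) rQ+ℓ≤rL)
    in  B , liftBasis B-indep (spanning-⊆ Q B₀⊆B (trans B₀-indep ∣B₀∣≡rQ)) (trans ∣B∣≡∣B₀∣+ℓ (cong (_+ ℓ) ∣B₀∣≡rQ))

  delete-repair : IsLiftBasis Q L i X → Spanning Q Y → u ∈ X → ¬ Spanning Q (X - u) →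
                  ∃[ v ] v ∈ (X - u) △ Y × IsLiftBasis Q L i ((X - u) △ ⁅ v ⁆)
  delete-repair {i = i} {X} {u = u} (liftBasis X-indep X-span ∣X∣) Y-span u∈X ¬X-u-span
    with nonspanning-increase Q Y-span ¬X-u-span
  ... | v , v∈Y , rQ-increase = v , x∉p∧x∈q⇒x∈p△q v∉X-u v∈Y ,
    subst (IsLiftBasis Q L i) (sym (x∉p⇒p△⁅x⁆≡p∪⁅x⁆ v∉X-u)) (liftBasis X-u+v-indep X-u+v-span ∣X-u+v∣)
    where
    open ≤-Reasoning
    v∉X-u : v ∉ X - u
    v∉X-u = rank<rank∪⁅⁆⇒∉ Q rQ-increase
    X-u+v-indep : Independent L ((X - u) ∪ ⁅ v ⁆)
    X-u+v-indep = independent-∪⁅⁆ L (independent-⊆ L (p─q⊆p X ⁅ u ⁆) X-indep) (≰⇒> λ rL-stable →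
      <⇒≱ rQ-increase (rank-L-stable⇒rank-Q-stable (p⊆p∪q _) rL-stable))
    X-u+v-span : Spanning Q ((X - u) ∪ ⁅ v ⁆)
    X-u+v-span = ≤-antisym (rank≤r Q _) (begin
      r Q                       ≡⟨ X-span ⟨
      rank Q X                  ≤⟨ rank-mono Q (p⊆[p-x]∪⁅x⁆ X u) ⟩
      rank Q ((X - u) ∪ ⁅ u ⁆)  ≤⟨ rank-∪⁅⁆ Q (X - u) u ⟩
      suc (rank Q (X - u))      ≤⟨ rQ-increase ⟩
      rank Q ((X - u) ∪ ⁅ v ⁆)  ∎)
    ∣X-u+v∣ : ∣ (X - u) ∪ ⁅ v ⁆ ∣ ≡ r Q + i
    ∣X-u+v∣ = trans (x∉p⇒∣p∪⁅x⁆∣≡1+∣p∣ v∉X-u) (trans (sym (x∈p⇒∣p∣≡1+∣p-x∣ u∈X)) ∣X∣)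

  insert-repair : IsLiftBasis Q L i X → Independent L Y → u ∉ X → ¬ Independent L (X ∪ ⁅ u ⁆) →
                  ∃[ v ] v ∈ (X ∪ ⁅ u ⁆) △ Y × IsLiftBasis Q L i ((X ∪ ⁅ u ⁆) △ ⁅ v ⁆)
  insert-repair {i = i} {X} {u = u} (liftBasis X-indep X-span ∣X∣) Y-indep u∉X ¬X+u-indep
    with dependent-non-coloop L Y-indep ¬X+u-indep
  ... | v , v∈X+u─Y , rL-stable = v , x∈p∧x∉q⇒x∈p△q v∈X+u (x∈p─q⇒x∉q v∈X+u─Y) ,
    subst (IsLiftBasis Q L i) (sym (x∈p⇒p△⁅x⁆≡p-x v∈X+u)) (liftBasis X+u-v-indep X+u-v-span (trans ∣X+u-v∣≡∣X∣ ∣X∣))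
    where
    open ≤-Reasoning
    v∈X+u : v ∈ X ∪ ⁅ u ⁆
    v∈X+u = p─q⊆p (X ∪ ⁅ u ⁆) _ v∈X+u─Y
    ∣X+u-v∣≡∣X∣ : ∣ (X ∪ ⁅ u ⁆) - v ∣ ≡ ∣ X ∣
    ∣X+u-v∣≡∣X∣ = suc-injective (trans (sym (x∈p⇒∣p∣≡1+∣p-x∣ v∈X+u)) (x∉p⇒∣p∪⁅x⁆∣≡1+∣p∣ u∉X))
    X+u-v-indep : Independent L ((X ∪ ⁅ u ⁆) - v)
    X+u-v-indep = ≤-antisym (rank-≤ L _) (begin
      ∣ (X ∪ ⁅ u ⁆) - v ∣       ≡⟨ ∣X+u-v∣≡∣X∣ ⟩
      ∣ X ∣                     ≡⟨ X-indep ⟨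
      rank L X                  ≤⟨ rank-mono L (p⊆p∪q _) ⟩
      rank L (X ∪ ⁅ u ⁆)        ≤⟨ rL-stable ⟩
      rank L ((X ∪ ⁅ u ⁆) - v)  ∎)
    X+u-v-span : Spanning Q ((X ∪ ⁅ u ⁆) - v)
    X+u-v-span = ≤-antisym (rank≤r Q _) (begin
      r Q                       ≡⟨ spanning-⊆ Q (p⊆p∪q _) X-span ⟨
      rank Q (X ∪ ⁅ u ⁆)        ≤⟨ rank-L-stable⇒rank-Q-stable (p─q⊆p (X ∪ ⁅ u ⁆) ⁅ v ⁆) rL-stable ⟩
      rank Q ((X ∪ ⁅ u ⁆) - v)  ∎)

  LiftBasisOrRepair : ℕ → Subset n → Subset n → Set
  LiftBasisOrRepair i Z Y =
    (∃[ m ] IsLiftBasis Q L m Z) ⊎ (∃[ v ] v ∈ Z △ Y × IsLiftBasis Q L i (Z △ ⁅ v ⁆))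

  toggle-move : IsLiftBasis Q L i X → IsLiftBasis Q L j Y → ∀ u →
                LiftBasisOrRepair i (X △ ⁅ u ⁆) Y
  toggle-move {X = X} X-basis Y-basis u with u ∈? X
  ... | yes u∈X rewrite x∈p⇒p△⁅x⁆≡p-x u∈X with rank Q (X - u) ≟ℕ r Q
  ...   | yes X-u-span =
    inj₁ (_ , spanning⇒liftBasis (independent-⊆ L (p─q⊆p X ⁅ u ⁆) (independent X-basis)) X-u-span)
  ...   | no ¬X-u-span = inj₂ (delete-repair X-basis (spanning Y-basis) u∈X ¬X-u-span)
  toggle-move {X = X} X-basis Y-basis u | no u∉X
    rewrite x∉p⇒p△⁅x⁆≡p∪⁅x⁆ u∉X with rank L (X ∪ ⁅ u ⁆) ≟ℕ ∣ X ∪ ⁅ u ⁆ ∣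
  ...   | yes X+u-indep = inj₁ (_ , spanning⇒liftBasis X+u-indep (spanning-⊆ Q (p⊆p∪q _) (spanning X-basis)))
  ...   | no ¬X+u-indep = inj₂ (insert-repair X-basis (independent Y-basis) u∉X ¬X+u-indep)

  module Exchange {P : ℕ → Set} (P? : Decidable P) (gap : ∀ ℓ → r Q + suc ℓ ≤ r L → P ℓ ⊎ P (suc ℓ)) where

    Feasible : Subset n → Set
    Feasible B = ∃[ ℓ ] P ℓ × IsLiftBasis Q L ℓ B

    lift-exchange : IsLiftBasis Q L ℓ Z → ¬ P ℓ → IsLiftBasis Q L j Y → P j →
                    ∃[ v ] v ∈ Z △ Y × Feasible (Z △ ⁅ v ⁆)
    lift-exchange {ℓ = ℓ} {j = j} Z-basis ¬Pℓ Y-basis Pj with <-cmp ℓ j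
    ... | tri≈ _ refl _ = contradiction Pj ¬Pℓ
    ... | tri< ℓ<j _ _ =
      let v , v∈Z△Y , W-basis = lift-augment Z-basis Y-basis ℓ<j
          P[1+ℓ] = fromInj₂ (flip contradiction ¬Pℓ) (gap ℓ (≤-trans (+-monoʳ-≤ (r Q) ℓ<j) (lift-bound Y-basis)))
      in  v , v∈Z△Y , suc ℓ , P[1+ℓ] , W-basis
    lift-exchange {ℓ = suc ℓ} Z-basis ¬P[1+ℓ] Y-basis Pj | tri> _ _ (s≤s j≤ℓ) =
      let v , v∈Z△Y , W-basis = lift-dual-augment Z-basis Y-basis j≤ℓ
      in  v , v∈Z△Y , ℓ , fromInj₁ (flip contradiction ¬P[1+ℓ]) (gap ℓ (lift-bound Z-basis)) , W-basis

    second-toggle : u ∈ X △ Y → ∃[ v ] v ∈ (X △ ⁅ u ⁆) △ Y × Feasible ((X △ ⁅ u ⁆) △ ⁅ v ⁆) →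
                    ∃[ v ] v ∈ X △ Y × Feasible (X △ (⁅ u ⁆ ∪ ⁅ v ⁆))
    second-toggle u∈X△Y (v , v∈[X△u]△Y , feasible) =
      let v∈X△Y , X△uv≡[X△u]△v = toggle-toward u∈X△Y v∈[X△u]△Y
      in  v , v∈X△Y , subst Feasible (sym X△uv≡[X△u]△v) feasible

    exchange : Feasible X → Feasible Y → u ∈ X △ Y → ∃[ v ] v ∈ X △ Y × Feasible (X △ (⁅ u ⁆ ∪ ⁅ v ⁆))
    exchange {X = X} {u = u} (i , Pi , X-basis) (j , Pj , Y-basis) u∈X△Y
      with toggle-move X-basis Y-basis u
    ... | inj₂ (v , v∈Z△Y , W-basis) = second-toggle u∈X△Y (v , v∈Z△Y , i , Pi , W-basis)
    ... | inj₁ (m , Z-basis) with P? m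
    ...   | yes Pm = u , u∈X△Y , subst Feasible (cong (X △_) (sym (∪-idem ⁅ u ⁆))) (m , Pm , Z-basis)
    ...   | no ¬Pm = second-toggle u∈X△Y (lift-exchange Z-basis ¬Pm Y-basis Pj)

  level-bound : ∀ (i : Fin (suc (r L ∸ r Q))) → r Q + toℕ i ≤ r L
  level-bound i =
    ≤-trans (+-monoʳ-≤ (r Q) (s≤s⁻¹ (toℕ<n i))) (≤-reflexive (m+[n∸m]≡n (rank-Q≤rank-L ⊤)))

  module _ (K : Subset (suc (r L ∸ r Q))) where

    levelIn-gap : NoConsecutiveGap K → ∀ ℓ → r Q + suc ℓ ≤ r L → LevelIn K ℓ ⊎ LevelIn K (suc ℓ)
    levelIn-gap gap ℓ rQ+1+ℓ≤rL = Sum.map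
      (λ ℓ∈K → _ , ℓ∈K , trans (toℕ-inject₁ _) (toℕ-fromℕ< 1+ℓ≤k))
      (λ 1+ℓ∈K → _ , 1+ℓ∈K , cong suc (toℕ-fromℕ< 1+ℓ≤k))
      (gap (fromℕ< 1+ℓ≤k))
      where
      1+ℓ≤k : suc ℓ ≤ r L ∸ r Q
      1+ℓ≤k = m+n≤o⇒m≤o∸n (suc ℓ) (subst (_≤ r L) (+-comm (r Q) (suc ℓ)) rQ+1+ℓ≤rL)

    higgsUnion⇒levelIn : HiggsUnion Q L K B → ∃[ ℓ ] LevelIn K ℓ × IsLiftBasis Q L ℓ B
    higgsUnion⇒levelIn (i , i∈K , B-basis) =
      toℕ i , (i , i∈K , refl) , higgsBasis⇒liftBasis (level-bound i) B-basis

    levelIn⇒higgsUnion : ∃[ ℓ ] LevelIn K ℓ × IsLiftBasis Q L ℓ B → HiggsUnion Q L K B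
    levelIn⇒higgsUnion (_ , (i , i∈K , refl) , B-basis) = i , i∈K , liftBasis⇒higgsBasis B-basis

proposition3p1 : ∀ {n} (L Q : Matroid n) → IsQuotient Q L →
    (K : Subset (suc (r L ∸ r Q))) → Nonempty K → NoConsecutiveGap K →
    IsDeltaMatroid (HiggsUnion Q L K)
proposition3p1 L Q quot K (i , i∈K) gap = nonempty , higgs-exchange
  where
  open HiggsLift Q L quot
  open Exchange (levelIn? K) (levelIn-gap K gap)

  nonempty : ∃[ B ] HiggsUnion Q L K B
  nonempty = let B , B-basis = lift-basis-exists (level-bound i)
             in  B , i , i∈K , liftBasis⇒higgsBasis B-basis

  higgs-exchange : ∀ X Y → HiggsUnion Q L K X → HiggsUnion Q L K Y → ∀ u → u ∈ X △ Y →
                   ∃[ v ] v ∈ X △ Y × HiggsUnion Q L K (X △ (⁅ u ⁆ ∪ ⁅ v ⁆))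
  higgs-exchange X Y X-feasible Y-feasible u u∈X△Y =
    let v , v∈X△Y , Z-feasible =
          exchange (higgsUnion⇒levelIn K X-feasible) (higgsUnion⇒levelIn K Y-feasible) u∈X△Y
    in  v , v∈X△Y , levelIn⇒higgsUnion K Z-feasible
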